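{- Let $K$ be a real number field and let $\beta_1,\beta_2\in\mathfrak{O}_K^+$ be an integral basis (a $\mathbb{Z}$-basis) of $\mathfrak{O}_K$. If $a,b\in\mathbb{N}$ are nonzero and $\alpha=ab\beta_2-a\beta_1\in\mathfrak{O}_K^+$, then $$C_\mathbb{Q}(\beta_1,\beta_2,\alpha)\cap\mathfrak{O}_K=\Big\{\tfrac{n}{a}\alpha+n_1\beta_1+n_2\beta_2\ \Big|\ n,n_1,n_2\in\mathbb{N}\Big\}=\mathrm{SG}\big(\beta_1,\beta_2,\tfrac{\alpha}{a}\big).$$
   Context: A real number field is a number field that is a subfield of $\mathbb{R}$; $\mathfrak{O}_K$ is its ring of integers and $\mathfrak{O}_K^+=\mathfrak{O}_K\cap[0,\infty)$. $\mathbb{N}=\{0,1,2,\dots\}$. For $\gamma_1,\dots,\gamma_k\in\mathfrak{O}_K^+$: $\mathrm{SG}(\gamma_1,\dots,\gamma_k)=\{\sum x_i\gamma_i\mid x_i\in\mathbb{N}\}$ and $C_\mathbb{Q}(\gamma_1,\dots,\gamma_k)=\{\sum x_i\gamma_i\mid x_i\in\mathbb{Q}_{\geqslant0}\}$. -}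

module Defs where

open import Data.Nat as ℕ using (ℕ; suc)
open import Data.Integer as ℤ using (ℤ; +_)
open import Data.Rational as ℚ using (ℚ; 0ℚ; 1ℚ)
open import Data.List using (List; []; _∷_)
open import Data.Product using (Σ; ∃; ∃-syntax; _×_; _,_)
open import Data.Sum using (_⊎_)
open import Data.Empty using (⊥)
open import Relation.Binary.PropositionalEquality using (_≡_)

-- Elements of the real quadratic field K = ℚ(√d) ⊂ ℝ (d ≥ 2 not a perfect
-- square, √d the positive real square root): re + im·√d.
record K : Set where
  constructor _+_√
  field
    re : ℚ
    im : ℚ
open K public

-- d is a parameter of the field (K = ℚ(√d)); it is only needed for
-- multiplication and for the real order.
NonSquare : ℕ → Set
NonSquare d = (k : ℕ) → k ℕ.* k ≡ d → ⊥

ℕtoℚ : ℕ → ℚ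
ℕtoℚ n = (+ n) ℚ./ 1

0K : K
0K = 0ℚ + 0ℚ √

1K : K
1K = 1ℚ + 0ℚ √

_⊕_ : K → K → K
(p + q √) ⊕ (r + s √) = (p ℚ.+ r) + (q ℚ.+ s) √

_⊖_ : K → K → K
(p + q √) ⊖ (r + s √) = (p ℚ.- r) + (q ℚ.- s) √

mulK : ℕ → K → K → K
mulK d (p + q √) (r + s √) =
  ((p ℚ.* r) ℚ.+ ((ℕtoℚ d) ℚ.* (q ℚ.* s))) + ((p ℚ.* s) ℚ.+ (q ℚ.* r)) √

_•_ : ℚ → K → K
c • (p + q √) = (c ℚ.* p) + (c ℚ.* q) √

_·ℕ_ : ℕ → K → K
n ·ℕ x = ℕtoℚ n • x

fromℤK : ℤ → K
fromℤK z = (z ℚ./ 1) + 0ℚ √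

-- Horner evaluation of the monic integer polynomial
-- X^m + c₁ X^(m-1) + … + c_m   (cs = c₁ ∷ … ∷ c_m ∷ [], highest degree first)
-- at x ∈ K.
hornerMonic : ℕ → List ℤ → K → K
hornerMonic d cs x = go cs 1K
  where
  go : List ℤ → K → K
  go []       acc = acc
  go (c ∷ cs) acc = go cs (mulK d acc x ⊕ fromℤK c)

IsAlgInt : ℕ → K → Set
IsAlgInt d x = Σ (List ℤ) λ cs → hornerMonic d cs x ≡ 0K

-- x ≥ 0 as a real number, where p + q√d is read in ℝ with √d > 0.
Nonneg : ℕ → K → Set
Nonneg d (p + q √) =
    (0ℚ ℚ.≤ p × 0ℚ ℚ.≤ q)
  ⊎ (0ℚ ℚ.≤ p × q ℚ.< 0ℚ × (ℕtoℚ d ℚ.* (q ℚ.* q)) ℚ.≤ (p ℚ.* p))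
  ⊎ (p ℚ.< 0ℚ × 0ℚ ℚ.< q × (p ℚ.* p) ℚ.≤ (ℕtoℚ d ℚ.* (q ℚ.* q)))

InOKPlus : ℕ → K → Set
InOKPlus d x = IsAlgInt d x × Nonneg d x

IsIntegralBasis : ℕ → K → K → Set
IsIntegralBasis d β₁ β₂ =
  IsAlgInt d β₁ × IsAlgInt d β₂ ×
  ((γ : K) → IsAlgInt d γ →
     ∃[ m₁ ] ∃[ m₂ ] (γ ≡ (((m₁ ℚ./ 1) • β₁) ⊕ ((m₂ ℚ./ 1) • β₂))
       × ((k₁ k₂ : ℤ) → γ ≡ (((k₁ ℚ./ 1) • β₁) ⊕ ((k₂ ℚ./ 1) • β₂)) →
            (k₁ ≡ m₁ × k₂ ≡ m₂))))

InConeℚ : K → K → K → K → Set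
InConeℚ γ₁ γ₂ γ₃ x =
  ∃[ q₁ ] ∃[ q₂ ] ∃[ q₃ ]
    (0ℚ ℚ.≤ q₁ × 0ℚ ℚ.≤ q₂ × 0ℚ ℚ.≤ q₃ ×
     x ≡ ((q₁ • γ₁) ⊕ (q₂ • γ₂)) ⊕ (q₃ • γ₃))

InSG : K → K → K → K → Set
InSG γ₁ γ₂ γ₃ x =
  ∃[ x₁ ] ∃[ x₂ ] ∃[ x₃ ] (x ≡ ((x₁ ·ℕ γ₁) ⊕ (x₂ ·ℕ γ₂)) ⊕ (x₃ ·ℕ γ₃))

{-# OPTIONS --safe #-}
-- Write γ in the integral basis, γ = m₁β₁ + m₂β₂ with m₁, m₂ ∈ ℤ.  Since β₁, β₂ are
-- ℚ-linearly independent, γ = q₁β₁ + q₂β₂ + q₃α means m₁ = q₁ − a q₃ and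
-- m₂ = q₂ + ab q₃; for q ≥ 0 this gives m₂ ≥ 0 and b m₁ + m₂ ≥ 0, so γ = m₁β₁ + m₂β₂
-- if m₁ ≥ 0 and γ = (−m₁/a)α + (m₂ + b m₁)β₂ otherwise.  Conversely
-- (n/a)α + n₁β₁ + n₂β₂ = (n₁ − n)β₁ + (n₂ + nb)β₂ is a ℤ-combination of algebraic
-- integers.  That such a combination is again an algebraic integer is shown via
-- bounded denominators: x is integral iff all its powers lie in (1/D)ℤ[√d] for one
-- D ≠ 0.  This property is closed under sums and products, and for x ∈ ℚ(√d) it makes
-- the trace and the norm of x rational numbers with bounded denominators of powers,
-- i.e. integers, so x is a root of X² − tr(x) X + N(x).
module Submission where

open import Defs
open import Algebra.Bundles using (CommutativeRing)
import Algebra.Properties.CommutativeSemiring.Exp as CommutativeSemiringExp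
import Algebra.Properties.Group as GroupProperties
import Algebra.Solver.Ring.NaturalCoefficients.Default as NaturalCoefficientsSolver
open import Data.Empty using (⊥-elim)
open import Data.Integer as ℤ using (ℤ; +_; -[1+_])
import Data.Integer.GCD as ℤGCD
import Data.Integer.Properties as ℤP
import Data.Integer.Tactic.RingSolver as ℤSolver
open import Data.List using (List; []; _∷_; length)
open import Data.Maybe using (Maybe; just; nothing)
open import Data.Nat as ℕ using (ℕ; zero; suc; NonZero; _≤_; _<_; _*_)
open import Data.Nat.Coprimality as Coprimality using (Coprime; coprime-divisor)
open import Data.Nat.Divisibility using (_∣_; divides; ∣-trans; ∣⇒≤; ∣1⇒≡1)
open import Data.Nat.Induction using (<-rec)
import Data.Nat.Properties as ℕP
open import Data.Product using (∃-syntax; _×_; _,_; proj₁; proj₂)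
open import Data.Rational as ℚ using (ℚ; 0ℚ; 1ℚ; _/_; ↥_; ↧_; ↧ₙ_)
import Data.Rational.Properties as ℚP
open import Data.Rational.Unnormalised as ℚᵘ using (mkℚᵘ; *≡*)
import Data.Rational.Unnormalised.Properties as ℚᵘP
open import Function.Bundles using (_⇔_; mk⇔)
open import Level using (0ℓ)
open import Relation.Binary.PropositionalEquality
open import Algebra.Structures {A = K} _≡_ using (IsCommutativeRing)
open import Relation.Nullary using (yes; no)
import Tactic.RingSolver as Solver
import Tactic.RingSolver.Core.AlmostCommutativeRing as ACR

open import Algebra.Definitions.RawSemiring ℚ.+-*-rawSemiring using () renaming (_^_ to _^ℚ_)

ℚ-ring : ACR.AlmostCommutativeRing 0ℓ 0ℓ
ℚ-ring = ACR.fromCommutativeRing ℚP.+-*-commutativeRing isZero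
  where
  isZero : ∀ x → Maybe (0ℚ ≡ x)
  isZero x with 0ℚ ℚP.≟ x
  ... | yes 0≡x = just 0≡x
  ... | no _    = nothing

ι : ℤ → ℚ
ι z = z / 1

toℚᵘ-ι : ∀ z → ℚ.toℚᵘ (ι z) ℚᵘ.≃ mkℚᵘ z 0
toℚᵘ-ι z = ℚP.toℚᵘ-fromℚᵘ (mkℚᵘ z 0)

ι-homo-+ : ∀ z w → ι (z ℤ.+ w) ≡ ι z ℚ.+ ι w
ι-homo-+ z w = ℚP.toℚᵘ-injective (begin
  ℚ.toℚᵘ (ι (z ℤ.+ w))             ≈⟨ toℚᵘ-ι (z ℤ.+ w) ⟩
  mkℚᵘ (z ℤ.+ w) 0                 ≈⟨ *≡* (cross-multiplied z w) ⟩
  mkℚᵘ z 0 ℚᵘ.+ mkℚᵘ w 0           ≈⟨ ℚᵘP.+-cong (toℚᵘ-ι z) (toℚᵘ-ι w) ⟨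
  ℚ.toℚᵘ (ι z) ℚᵘ.+ ℚ.toℚᵘ (ι w)   ≈⟨ ℚP.toℚᵘ-homo-+ (ι z) (ι w) ⟨
  ℚ.toℚᵘ (ι z ℚ.+ ι w)             ∎)
  where
  open ℚᵘP.≃-Reasoning
  cross-multiplied : ∀ z w → (z ℤ.+ w) ℤ.* (+ 1 ℤ.* + 1) ≡ (z ℤ.* + 1 ℤ.+ w ℤ.* + 1) ℤ.* + 1
  cross-multiplied = ℤSolver.solve-∀

ι-homo-* : ∀ z w → ι (z ℤ.* w) ≡ ι z ℚ.* ι w
ι-homo-* z w = ℚP.toℚᵘ-injective (begin
  ℚ.toℚᵘ (ι (z ℤ.* w))             ≈⟨ toℚᵘ-ι (z ℤ.* w) ⟩
  mkℚᵘ (z ℤ.* w) 0                 ≈⟨ *≡* (cross-multiplied z w) ⟩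
  mkℚᵘ z 0 ℚᵘ.* mkℚᵘ w 0           ≈⟨ ℚᵘP.*-cong (toℚᵘ-ι z) (toℚᵘ-ι w) ⟨
  ℚ.toℚᵘ (ι z) ℚᵘ.* ℚ.toℚᵘ (ι w)   ≈⟨ ℚP.toℚᵘ-homo-* (ι z) (ι w) ⟨
  ℚ.toℚᵘ (ι z ℚ.* ι w)             ∎)
  where
  open ℚᵘP.≃-Reasoning
  cross-multiplied : ∀ z w → (z ℤ.* w) ℤ.* (+ 1 ℤ.* + 1) ≡ (z ℤ.* w) ℤ.* + 1
  cross-multiplied = ℤSolver.solve-∀

ι-homo‿- : ∀ z → ι (ℤ.- z) ≡ ℚ.- ι z
ι-homo‿- z = ℚP.toℚᵘ-injective (begin
  ℚ.toℚᵘ (ι (ℤ.- z))      ≈⟨ toℚᵘ-ι (ℤ.- z) ⟩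
  ℚᵘ.- mkℚᵘ z 0           ≈⟨ ℚᵘP.-‿cong (toℚᵘ-ι z) ⟨
  ℚᵘ.- ℚ.toℚᵘ (ι z)       ≈⟨ ℚP.toℚᵘ-homo‿- (ι z) ⟨
  ℚ.toℚᵘ (ℚ.- ι z)        ∎)
  where open ℚᵘP.≃-Reasoning

ℕtoℚ-homo-+ : ∀ m n → ℕtoℚ (m ℕ.+ n) ≡ ℕtoℚ m ℚ.+ ℕtoℚ n
ℕtoℚ-homo-+ m n = trans (cong ι (ℤP.pos-+ m n)) (ι-homo-+ (+ m) (+ n))

ℕtoℚ-homo-* : ∀ m n → ℕtoℚ (m * n) ≡ ℕtoℚ m ℚ.* ℕtoℚ n
ℕtoℚ-homo-* m n = trans (cong ι (ℤP.pos-* m n)) (ι-homo-* (+ m) (+ n))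

ι-injective : ∀ {z w} → ι z ≡ ι w → z ≡ w
ι-injective {z} {w} ιz≡ιw
  with ℚᵘP.≃-trans (ℚᵘP.≃-sym (toℚᵘ-ι z)) (ℚᵘP.≃-trans (ℚP.toℚᵘ-cong ιz≡ιw) (toℚᵘ-ι w))
... | *≡* z*1≡w*1 = trans (sym (ℤP.*-identityʳ z)) (trans z*1≡w*1 (ℤP.*-identityʳ w))

↥-ι : ∀ z → ↥ ι z ≡ z
↥-ι z = trans (sym (ℤP.*-identityʳ _)) (trans (cong (↥ ι z ℤ.*_) (sym (ℤGCD.gcd-zeroʳ z))) (ℚP.↥-/ z 1))

↧-ι : ∀ z → ↧ ι z ≡ + 1
↧-ι z = trans (sym (ℤP.*-identityʳ _)) (trans (cong (↧ ι z ℤ.*_) (sym (ℤGCD.gcd-zeroʳ z))) (ℚP.↧-/ z 1))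

ι-cancel-≤ : ∀ {z w} → ι z ℚ.≤ ι w → z ℤ.≤ w
ι-cancel-≤ {z} {w} ιz≤ιw = subst₂ ℤ._≤_ (cross z w) (cross w z) (ℚP.drop-*≤* ιz≤ιw)
  where
  cross : ∀ z w → ↥ ι z ℤ.* ↧ ι w ≡ z
  cross z w = trans (cong₂ ℤ._*_ (↥-ι z) (↧-ι w)) (ℤP.*-identityʳ z)

ι↧*≡ι↥ : ∀ r → ι (↧ r) ℚ.* r ≡ ι (↥ r)
ι↧*≡ι↥ r@(ℚ.mkℚ n d-1 _) = ℚP.toℚᵘ-injective (begin
  ℚ.toℚᵘ (ι (↧ r) ℚ.* r)              ≈⟨ ℚP.toℚᵘ-homo-* (ι (↧ r)) r ⟩
  ℚ.toℚᵘ (ι (↧ r)) ℚᵘ.* ℚ.toℚᵘ r      ≈⟨ ℚᵘP.*-congʳ (toℚᵘ-ι (↧ r)) ⟩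
  mkℚᵘ (↧ r) 0 ℚᵘ.* ℚ.toℚᵘ r          ≈⟨ *≡* cross-multiplied ⟩
  mkℚᵘ n 0                            ≈⟨ toℚᵘ-ι n ⟨
  ℚ.toℚᵘ (ι n)                        ∎)
  where
  open ℚᵘP.≃-Reasoning
  cross-multiplied : (+ suc d-1 ℤ.* n) ℤ.* + 1 ≡ n ℤ.* + (suc (d-1 ℕ.+ 0))
  cross-multiplied rewrite ℕP.+-identityʳ d-1 = trans (ℤP.*-identityʳ _) (ℤP.*-comm (+ suc d-1) n)

Integral : ℚ → Set
Integral r = ∃[ z ] r ≡ ι z

Integral-ι : ∀ z → Integral (ι z)
Integral-ι z = z , refl

Integral-+ : ∀ {r s} → Integral r → Integral s → Integral (r ℚ.+ s)
Integral-+ (z , refl) (w , refl) = z ℤ.+ w , sym (ι-homo-+ z w)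

Integral-* : ∀ {r s} → Integral r → Integral s → Integral (r ℚ.* s)
Integral-* (z , refl) (w , refl) = z ℤ.* w , sym (ι-homo-* z w)

Integral-neg : ∀ {r} → Integral r → Integral (ℚ.- r)
Integral-neg (z , refl) = ℤ.- z , sym (ι-homo‿- z)

common-denominator : ∀ r s → Integral (ℕtoℚ (↧ₙ r * ↧ₙ s) ℚ.* r) × Integral (ℕtoℚ (↧ₙ r * ↧ₙ s) ℚ.* s)
common-denominator r s =
    (↧ s ℤ.* ↥ r , clears {↧ₙ r * ↧ₙ s} r s (trans (ℕtoℚ-homo-* (↧ₙ r) (↧ₙ s)) (ℚP.*-comm (ι (↧ r)) (ι (↧ s)))))
  , (↧ r ℤ.* ↥ s , clears {↧ₙ r * ↧ₙ s} s r (ℕtoℚ-homo-* (↧ₙ r) (↧ₙ s)))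
  where
  clears : ∀ {D} r s → ℕtoℚ D ≡ ι (↧ s) ℚ.* ι (↧ r) → ℕtoℚ D ℚ.* r ≡ ι (↧ s ℤ.* ↥ r)
  clears {D} r s D≡ = begin
    ℕtoℚ D ℚ.* r                   ≡⟨ cong (ℚ._* r) D≡ ⟩
    (ι (↧ s) ℚ.* ι (↧ r)) ℚ.* r    ≡⟨ ℚP.*-assoc (ι (↧ s)) (ι (↧ r)) r ⟩
    ι (↧ s) ℚ.* (ι (↧ r) ℚ.* r)    ≡⟨ cong (ι (↧ s) ℚ.*_) (ι↧*≡ι↥ r) ⟩
    ι (↧ s) ℚ.* ι (↥ r)            ≡⟨ ι-homo-* (↧ s) (↥ r) ⟨
    ι (↧ s ℤ.* ↥ r)                ∎
    where open ≡-Reasoning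

coprime-* : ∀ {m a b} → Coprime m a → Coprime m b → Coprime m (a * b)
coprime-* coprime-a coprime-b (i∣m , i∣ab) = coprime-b (i∣m , coprime-divisor (λ (j∣i , j∣a) → coprime-a (∣-trans j∣i i∣m , j∣a)) i∣ab)

coprime-^ : ∀ {m a} k → Coprime m a → Coprime m (a ℕ.^ k)
coprime-^ zero    _         (_ , i∣1) = ∣1⇒≡1 i∣1
coprime-^ (suc k) coprime-a = coprime-* coprime-a (coprime-^ k coprime-a)

coprime-^-^ : ∀ {m a} k → Coprime m a → Coprime (m ℕ.^ k) (a ℕ.^ k)
coprime-^-^ k coprime-a = Coprimality.sym (coprime-^ k (Coprimality.sym (coprime-^ k coprime-a)))

n<m^n : ∀ m → 1 < m → ∀ n → n < m ℕ.^ n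
n<m^n m 1<m zero    = ℕ.s≤s ℕ.z≤n
n<m^n m 1<m (suc n) = ℕP.≤-<-trans (n<m^n m 1<m n) (ℕP.^-monoʳ-< m 1<m (ℕP.n<1+n n))

∣^∣ : ∀ i k → ℤ.∣ i ℤ.^ k ∣ ≡ ℤ.∣ i ∣ ℕ.^ k
∣^∣ i zero    = refl
∣^∣ i (suc k) = trans (ℤP.abs-* i (i ℤ.^ k)) (cong (ℤ.∣ i ∣ *_) (∣^∣ i k))

-- With r = n/m in lowest terms, D·r^k ∈ ℤ gives m^k ∣ D·n^k, hence m^k ∣ D for every k, forcing m = 1.
bounded-powers⇒integral : ∀ r D .{{_ : NonZero D}} → (∀ k → Integral (ℕtoℚ D ℚ.* r ^ℚ k)) → Integral r
bounded-powers⇒integral r@(ℚ.mkℚ _ _ coprime) D bounded = ↥ r , (begin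
  r                   ≡⟨ ℚP.*-identityˡ r ⟨
  ι (+ 1) ℚ.* r       ≡⟨ cong (λ t → ℕtoℚ t ℚ.* r) m≡1 ⟨
  ι (↧ r) ℚ.* r       ≡⟨ ι↧*≡ι↥ r ⟩
  ι (↥ r)             ∎)
  where
  open ≡-Reasoning
  m = ↧ₙ r
  n = ↥ r
  clear-powers : ∀ k → ℕtoℚ (m ℕ.^ k) ℚ.* r ^ℚ k ≡ ι (n ℤ.^ k)
  clear-powers zero    = ℚP.*-identityʳ 1ℚ
  clear-powers (suc k) = begin
    ℕtoℚ (m * m ℕ.^ k) ℚ.* (r ℚ.* r ^ℚ k)                 ≡⟨ cong (ℚ._* (r ℚ.* r ^ℚ k)) (ℕtoℚ-homo-* m (m ℕ.^ k)) ⟩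
    (ι (↧ r) ℚ.* ℕtoℚ (m ℕ.^ k)) ℚ.* (r ℚ.* r ^ℚ k)       ≡⟨ interchange (ι (↧ r)) (ℕtoℚ (m ℕ.^ k)) r (r ^ℚ k) ⟩
    (ι (↧ r) ℚ.* r) ℚ.* (ℕtoℚ (m ℕ.^ k) ℚ.* r ^ℚ k)       ≡⟨ cong₂ ℚ._*_ (ι↧*≡ι↥ r) (clear-powers k) ⟩
    ι n ℚ.* ι (n ℤ.^ k)                                   ≡⟨ ι-homo-* n (n ℤ.^ k) ⟨
    ι (n ℤ.^ suc k)                                       ∎
    where
    interchange : ∀ a b c e → (a ℚ.* b) ℚ.* (c ℚ.* e) ≡ (a ℚ.* c) ℚ.* (b ℚ.* e)
    interchange = Solver.solve-∀ ℚ-ring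
  m^k∣D : ∀ k → m ℕ.^ k ∣ D
  m^k∣D k = coprime-divisor (coprime-^-^ k (Coprimality.sym (Coprimality.recompute coprime)))
                            (divides ℤ.∣ z ∣ (trans (ℕP.*-comm (ℤ.∣ n ∣ ℕ.^ k) D) (trans (sym ∣eq∣) (ℕP.*-comm (m ℕ.^ k) ℤ.∣ z ∣))))
    where
    z = proj₁ (bounded k)
    eq : + (m ℕ.^ k) ℤ.* z ≡ + D ℤ.* n ℤ.^ k
    eq = ι-injective (begin
      ι (+ (m ℕ.^ k) ℤ.* z)                    ≡⟨ ι-homo-* (+ (m ℕ.^ k)) z ⟩
      ℕtoℚ (m ℕ.^ k) ℚ.* ι z                   ≡⟨ cong (ℕtoℚ (m ℕ.^ k) ℚ.*_) (proj₂ (bounded k)) ⟨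
      ℕtoℚ (m ℕ.^ k) ℚ.* (ℕtoℚ D ℚ.* r ^ℚ k)   ≡⟨ swap (ℕtoℚ (m ℕ.^ k)) (ℕtoℚ D) (r ^ℚ k) ⟩
      ℕtoℚ D ℚ.* (ℕtoℚ (m ℕ.^ k) ℚ.* r ^ℚ k)   ≡⟨ cong (ℕtoℚ D ℚ.*_) (clear-powers k) ⟩
      ℕtoℚ D ℚ.* ι (n ℤ.^ k)                   ≡⟨ ι-homo-* (+ D) (n ℤ.^ k) ⟨
      ι (+ D ℤ.* n ℤ.^ k)                      ∎)
      where
      swap : ∀ a b c → a ℚ.* (b ℚ.* c) ≡ b ℚ.* (a ℚ.* c)
      swap = Solver.solve-∀ ℚ-ring
    ∣eq∣ : m ℕ.^ k * ℤ.∣ z ∣ ≡ D * ℤ.∣ n ∣ ℕ.^ k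
    ∣eq∣ = trans (sym (ℤP.abs-* (+ (m ℕ.^ k)) z))
           (trans (cong ℤ.∣_∣ eq) (trans (ℤP.abs-* (+ D) (n ℤ.^ k)) (cong (D *_) (∣^∣ n k))))
  m≡1 : m ≡ 1
  m≡1 with 2 ℕ.≤? m
  ... | yes 1<m = ⊥-elim (ℕP.<⇒≱ (n<m^n m 1<m D) (∣⇒≤ (m^k∣D D)))
  ... | no  1≮m = ℕP.≤-antisym (ℕP.≤-pred (ℕP.≰⇒> 1≮m)) (ℕ.s≤s ℕ.z≤n)

*-cancelʳ-≡ : ∀ c .{{_ : ℚ.NonZero c}} {p q} → p ℚ.* c ≡ q ℚ.* c → p ≡ q
*-cancelʳ-≡ c {p} {q} pc≡qc = begin
  p                          ≡⟨ ℚP.*-identityʳ p ⟨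
  p ℚ.* 1ℚ                   ≡⟨ cong (p ℚ.*_) (ℚP.*-inverseʳ c) ⟨
  p ℚ.* (c ℚ.* ℚ.1/ c)       ≡⟨ ℚP.*-assoc p c (ℚ.1/ c) ⟨
  (p ℚ.* c) ℚ.* ℚ.1/ c       ≡⟨ cong (ℚ._* ℚ.1/ c) pc≡qc ⟩
  (q ℚ.* c) ℚ.* ℚ.1/ c       ≡⟨ ℚP.*-assoc q c (ℚ.1/ c) ⟩
  q ℚ.* (c ℚ.* ℚ.1/ c)       ≡⟨ cong (q ℚ.*_) (ℚP.*-inverseʳ c) ⟩
  q ℚ.* 1ℚ                   ≡⟨ ℚP.*-identityʳ q ⟩
  q                          ∎
  where open ≡-Reasoning

ℕtoℚ-nonZero : ∀ n .{{_ : NonZero n}} → ℚ.NonZero (ℕtoℚ n)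
ℕtoℚ-nonZero n = ℚP.pos⇒nonZero (ℕtoℚ n) {{ℚP.normalize-pos n 1}}

n/a*a≡n : ∀ n a .{{_ : NonZero a}} → ((+ n) / a) ℚ.* ℕtoℚ a ≡ ℕtoℚ n
n/a*a≡n n (suc a-1) = ℚP.toℚᵘ-injective (begin
  ℚ.toℚᵘ (((+ n) / suc a-1) ℚ.* ℕtoℚ (suc a-1))               ≈⟨ ℚP.toℚᵘ-homo-* ((+ n) / suc a-1) (ℕtoℚ (suc a-1)) ⟩
  ℚ.toℚᵘ ((+ n) / suc a-1) ℚᵘ.* ℚ.toℚᵘ (ℕtoℚ (suc a-1))       ≈⟨ ℚᵘP.*-cong (ℚP.toℚᵘ-fromℚᵘ (mkℚᵘ (+ n) a-1)) (toℚᵘ-ι (+ suc a-1)) ⟩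
  mkℚᵘ (+ n) a-1 ℚᵘ.* mkℚᵘ (+ suc a-1) 0                      ≈⟨ *≡* cross-multiplied ⟩
  mkℚᵘ (+ n) 0                                                ≈⟨ toℚᵘ-ι (+ n) ⟨
  ℚ.toℚᵘ (ℕtoℚ n)                                             ∎)
  where
  open ℚᵘP.≃-Reasoning
  cross-multiplied : (+ n ℤ.* + suc a-1) ℤ.* + 1 ≡ + n ℤ.* + (suc a-1 * 1)
  cross-multiplied = trans (ℤP.*-identityʳ _) (cong (λ t → + n ℤ.* + t) (sym (ℕP.*-identityʳ (suc a-1))))

n*[1/a]≡n/a : ∀ n a .{{_ : NonZero a}} → ℕtoℚ n ℚ.* ((+ 1) / a) ≡ (+ n) / a
n*[1/a]≡n/a n a = *-cancelʳ-≡ (ℕtoℚ a) {{ℕtoℚ-nonZero a}} (begin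
  (ℕtoℚ n ℚ.* ((+ 1) / a)) ℚ.* ℕtoℚ a     ≡⟨ ℚP.*-assoc (ℕtoℚ n) ((+ 1) / a) (ℕtoℚ a) ⟩
  ℕtoℚ n ℚ.* (((+ 1) / a) ℚ.* ℕtoℚ a)     ≡⟨ cong (ℕtoℚ n ℚ.*_) (n/a*a≡n 1 a) ⟩
  ℕtoℚ n ℚ.* 1ℚ                           ≡⟨ ℚP.*-identityʳ (ℕtoℚ n) ⟩
  ℕtoℚ n                                  ≡⟨ n/a*a≡n n a ⟨
  ((+ n) / a) ℚ.* ℕtoℚ a                  ∎)
  where open ≡-Reasoning

0≤n/a : ∀ n a .{{_ : NonZero a}} → 0ℚ ℚ.≤ (+ n) / a
0≤n/a n a = ℚP.nonNegative⁻¹ _ {{ℚP.normalize-nonNeg n a}}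

0≤+ : ∀ {x y} → 0ℚ ℚ.≤ x → 0ℚ ℚ.≤ y → 0ℚ ℚ.≤ x ℚ.+ y
0≤+ {x} {y} 0≤x 0≤y = ℚP.nonNegative⁻¹ _ {{ℚP.nonNeg+nonNeg⇒nonNeg x {{ℚ.nonNegative 0≤x}} y {{ℚ.nonNegative 0≤y}}}}

0≤* : ∀ {x y} → 0ℚ ℚ.≤ x → 0ℚ ℚ.≤ y → 0ℚ ℚ.≤ x ℚ.* y
0≤* {x} {y} 0≤x 0≤y = ℚP.nonNegative⁻¹ _ {{ℚP.nonNeg*nonNeg⇒nonNeg x {{ℚ.nonNegative 0≤x}} y {{ℚ.nonNegative 0≤y}}}}

negK : K → K
negK (p + q √) = (ℚ.- p) + (ℚ.- q) √

conj : K → K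
conj (p + q √) = p + (ℚ.- q) √

fromℚK : ℚ → K
fromℚK c = c + 0ℚ √

•-distrib-⊕ : ∀ c x y → c • (x ⊕ y) ≡ (c • x) ⊕ (c • y)
•-distrib-⊕ c x y = cong₂ _+_√ (ℚP.*-distribˡ-+ c (re x) (re y)) (ℚP.*-distribˡ-+ c (im x) (im y))

•-negK : ∀ c x → c • negK x ≡ negK (c • x)
•-negK c x = cong₂ _+_√ (sym (ℚP.neg-distribʳ-* c (re x))) (sym (ℚP.neg-distribʳ-* c (im x)))

•-conj : ∀ c x → c • conj x ≡ conj (c • x)
•-conj c x = cong₂ _+_√ refl (sym (ℚP.neg-distribʳ-* c (im x)))

•-assoc : ∀ c e x → c • (e • x) ≡ (c ℚ.* e) • x
•-assoc c e x = cong₂ _+_√ (sym (ℚP.*-assoc c e (re x))) (sym (ℚP.*-assoc c e (im x)))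

•-comm : ∀ c e x → c • (e • x) ≡ e • (c • x)
•-comm c e x = trans (•-assoc c e x) (trans (cong (_• x) (ℚP.*-comm c e)) (sym (•-assoc e c x)))

IntegralCoords : K → Set
IntegralCoords x = Integral (re x) × Integral (im x)

IntegralCoords-⊕ : ∀ {x y} → IntegralCoords x → IntegralCoords y → IntegralCoords (x ⊕ y)
IntegralCoords-⊕ (p , q) (r , s) = Integral-+ p r , Integral-+ q s

IntegralCoords-negK : ∀ {x} → IntegralCoords x → IntegralCoords (negK x)
IntegralCoords-negK (p , q) = Integral-neg p , Integral-neg q

IntegralCoords-conj : ∀ {x} → IntegralCoords x → IntegralCoords (conj x)
IntegralCoords-conj (p , q) = p , Integral-neg q

IntegralCoords-• : ∀ {c x} → Integral c → IntegralCoords x → IntegralCoords (c • x)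
IntegralCoords-• c (p , q) = Integral-* c p , Integral-* c q

record HasDenominator (D : ℕ) (x : K) : Set where
  constructor hasDenominator
  field clears : IntegralCoords (ℕtoℚ D • x)

denominator : ∀ x → HasDenominator (↧ₙ (re x) * ↧ₙ (im x)) x
denominator x = hasDenominator (common-denominator (re x) (im x))

IntegralCoords⇒HasDenominator-1 : ∀ {x} → IntegralCoords x → HasDenominator 1 x
IntegralCoords⇒HasDenominator-1 {x} ix =
  hasDenominator (subst IntegralCoords (sym (cong₂ _+_√ (ℚP.*-identityˡ (re x)) (ℚP.*-identityˡ (im x)))) ix)

HasDenominator-0K : ∀ D → HasDenominator D 0K
HasDenominator-0K D = hasDenominator (D*0∈ℤ , D*0∈ℤ)
  where
  D*0∈ℤ : Integral (ℕtoℚ D ℚ.* 0ℚ)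
  D*0∈ℤ = subst Integral (sym (ℚP.*-zeroʳ (ℕtoℚ D))) (Integral-ι (+ 0))

HasDenominator-⊕ : ∀ {D x y} → HasDenominator D x → HasDenominator D y → HasDenominator D (x ⊕ y)
HasDenominator-⊕ {D} {x} {y} (hasDenominator Dx) (hasDenominator Dy) =
  hasDenominator (subst IntegralCoords (sym (•-distrib-⊕ (ℕtoℚ D) x y)) (IntegralCoords-⊕ Dx Dy))

HasDenominator-negK : ∀ {D x} → HasDenominator D x → HasDenominator D (negK x)
HasDenominator-negK {D} {x} (hasDenominator Dx) =
  hasDenominator (subst IntegralCoords (sym (•-negK (ℕtoℚ D) x)) (IntegralCoords-negK Dx))

HasDenominator-conj : ∀ {D x} → HasDenominator D x → HasDenominator D (conj x)
HasDenominator-conj {D} {x} (hasDenominator Dx) =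
  hasDenominator (subst IntegralCoords (sym (•-conj (ℕtoℚ D) x)) (IntegralCoords-conj Dx))

HasDenominator-• : ∀ {D c x} → Integral c → HasDenominator D x → HasDenominator D (c • x)
HasDenominator-• {D} {c} {x} c∈ℤ (hasDenominator Dx) =
  hasDenominator (subst IntegralCoords (•-comm c (ℕtoℚ D) x) (IntegralCoords-• c∈ℤ Dx))

HasDenominator-*ʳ : ∀ {D x} E → HasDenominator D x → HasDenominator (D * E) x
HasDenominator-*ʳ {D} {x} E (hasDenominator Dx) = hasDenominator (subst IntegralCoords (begin
  ℕtoℚ E • (ℕtoℚ D • x)          ≡⟨ •-assoc (ℕtoℚ E) (ℕtoℚ D) x ⟩
  (ℕtoℚ E ℚ.* ℕtoℚ D) • x        ≡⟨ cong (_• x) (ℚP.*-comm (ℕtoℚ E) (ℕtoℚ D)) ⟩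
  (ℕtoℚ D ℚ.* ℕtoℚ E) • x        ≡⟨ cong (_• x) (ℕtoℚ-homo-* D E) ⟨
  ℕtoℚ (D * E) • x               ∎) (IntegralCoords-• (Integral-ι (+ E)) Dx))
  where open ≡-Reasoning

HasDenominator-*ˡ : ∀ {D x} E → HasDenominator D x → HasDenominator (E * D) x
HasDenominator-*ˡ {D} {x} E Dx = subst (λ F → HasDenominator F x) (ℕP.*-comm D E) (HasDenominator-*ʳ E Dx)

-- The loop of hornerMonic lives in an anonymous where-block; abstracting its arguments
-- with `with` lets unification solve hornerLoop as that very function.
mutual
  hornerLoop : ℕ → List ℤ → K → List ℤ → K → K
  hornerLoop = _

  private
    hornerLoop-solution : ∀ d c cs x → hornerMonic d (c ∷ cs) x ≡ hornerMonic d (c ∷ cs) x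
    hornerLoop-solution d c cs x with c ∷ cs | mulK d 1K x ⊕ fromℤK c
    ... | cs₀ | acc = refl {x = hornerLoop d cs₀ x cs acc}

module QuadraticField (d : ℕ) where

  infixl 25 _·_
  _·_ : K → K → K
  _·_ = mulK d

  private
    dℚ = ℕtoℚ d

    ·-assoc-re : ∀ p q r s t u D → (p ℚ.* r ℚ.+ D ℚ.* (q ℚ.* s)) ℚ.* t ℚ.+ D ℚ.* ((p ℚ.* s ℚ.+ q ℚ.* r) ℚ.* u)
                                  ≡ p ℚ.* (r ℚ.* t ℚ.+ D ℚ.* (s ℚ.* u)) ℚ.+ D ℚ.* (q ℚ.* (r ℚ.* u ℚ.+ s ℚ.* t))
    ·-assoc-re = Solver.solve-∀ ℚ-ring
    ·-assoc-im : ∀ p q r s t u D → (p ℚ.* r ℚ.+ D ℚ.* (q ℚ.* s)) ℚ.* u ℚ.+ (p ℚ.* s ℚ.+ q ℚ.* r) ℚ.* t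
                                  ≡ p ℚ.* (r ℚ.* u ℚ.+ s ℚ.* t) ℚ.+ q ℚ.* (r ℚ.* t ℚ.+ D ℚ.* (s ℚ.* u))
    ·-assoc-im = Solver.solve-∀ ℚ-ring
    ·-identityˡ-re : ∀ p q D → 1ℚ ℚ.* p ℚ.+ D ℚ.* (0ℚ ℚ.* q) ≡ p
    ·-identityˡ-re = Solver.solve-∀ ℚ-ring
    ·-identityˡ-im : ∀ p q → 1ℚ ℚ.* q ℚ.+ 0ℚ ℚ.* p ≡ q
    ·-identityˡ-im = Solver.solve-∀ ℚ-ring
    ·-identityʳ-re : ∀ p q D → p ℚ.* 1ℚ ℚ.+ D ℚ.* (q ℚ.* 0ℚ) ≡ p
    ·-identityʳ-re = Solver.solve-∀ ℚ-ring
    ·-identityʳ-im : ∀ p q → p ℚ.* 0ℚ ℚ.+ q ℚ.* 1ℚ ≡ q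
    ·-identityʳ-im = Solver.solve-∀ ℚ-ring
    ·-distribˡ-re : ∀ p q r s t u D → p ℚ.* (r ℚ.+ t) ℚ.+ D ℚ.* (q ℚ.* (s ℚ.+ u))
                                     ≡ (p ℚ.* r ℚ.+ D ℚ.* (q ℚ.* s)) ℚ.+ (p ℚ.* t ℚ.+ D ℚ.* (q ℚ.* u))
    ·-distribˡ-re = Solver.solve-∀ ℚ-ring
    ·-distribˡ-im : ∀ p q r s t u → p ℚ.* (s ℚ.+ u) ℚ.+ q ℚ.* (r ℚ.+ t)
                                   ≡ (p ℚ.* s ℚ.+ q ℚ.* r) ℚ.+ (p ℚ.* u ℚ.+ q ℚ.* t)
    ·-distribˡ-im = Solver.solve-∀ ℚ-ring
    ·-distribʳ-re : ∀ p q r s t u D → (r ℚ.+ t) ℚ.* p ℚ.+ D ℚ.* ((s ℚ.+ u) ℚ.* q)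
                                     ≡ (r ℚ.* p ℚ.+ D ℚ.* (s ℚ.* q)) ℚ.+ (t ℚ.* p ℚ.+ D ℚ.* (u ℚ.* q))
    ·-distribʳ-re = Solver.solve-∀ ℚ-ring
    ·-distribʳ-im : ∀ p q r s t u → (r ℚ.+ t) ℚ.* q ℚ.+ (s ℚ.+ u) ℚ.* p
                                   ≡ (r ℚ.* q ℚ.+ s ℚ.* p) ℚ.+ (t ℚ.* q ℚ.+ u ℚ.* p)
    ·-distribʳ-im = Solver.solve-∀ ℚ-ring
    ·-comm-re : ∀ p q r s D → p ℚ.* r ℚ.+ D ℚ.* (q ℚ.* s) ≡ r ℚ.* p ℚ.+ D ℚ.* (s ℚ.* q)
    ·-comm-re = Solver.solve-∀ ℚ-ring
    ·-comm-im : ∀ p q r s → p ℚ.* s ℚ.+ q ℚ.* r ≡ r ℚ.* q ℚ.+ s ℚ.* p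
    ·-comm-im = Solver.solve-∀ ℚ-ring

  K-isCommutativeRing : IsCommutativeRing _⊕_ _·_ negK 0K 1K
  K-isCommutativeRing = record
    { isRing = record
      { +-isAbelianGroup = record
        { isGroup = record
          { isMonoid = record
            { isSemigroup = record
              { isMagma = record { isEquivalence = isEquivalence ; ∙-cong = cong₂ _⊕_ }
              ; assoc   = λ x y z → cong₂ _+_√ (ℚP.+-assoc (re x) (re y) (re z)) (ℚP.+-assoc (im x) (im y) (im z))
              }
            ; identity = (λ x → cong₂ _+_√ (ℚP.+-identityˡ (re x)) (ℚP.+-identityˡ (im x)))
                       , (λ x → cong₂ _+_√ (ℚP.+-identityʳ (re x)) (ℚP.+-identityʳ (im x)))
            }
          ; inverse = (λ x → cong₂ _+_√ (ℚP.+-inverseˡ (re x)) (ℚP.+-inverseˡ (im x)))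
                    , (λ x → cong₂ _+_√ (ℚP.+-inverseʳ (re x)) (ℚP.+-inverseʳ (im x)))
          ; ⁻¹-cong = cong negK
          }
        ; comm = λ x y → cong₂ _+_√ (ℚP.+-comm (re x) (re y)) (ℚP.+-comm (im x) (im y))
        }
      ; *-cong     = cong₂ _·_
      ; *-assoc    = λ x y z → cong₂ _+_√ (·-assoc-re (re x) (im x) (re y) (im y) (re z) (im z) dℚ)
                                          (·-assoc-im (re x) (im x) (re y) (im y) (re z) (im z) dℚ)
      ; *-identity = (λ x → cong₂ _+_√ (·-identityˡ-re (re x) (im x) dℚ) (·-identityˡ-im (re x) (im x)))
                   , (λ x → cong₂ _+_√ (·-identityʳ-re (re x) (im x) dℚ) (·-identityʳ-im (re x) (im x)))
      ; distrib    = (λ x y z → cong₂ _+_√ (·-distribˡ-re (re x) (im x) (re y) (im y) (re z) (im z) dℚ)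
                                           (·-distribˡ-im (re x) (im x) (re y) (im y) (re z) (im z)))
                   , (λ x y z → cong₂ _+_√ (·-distribʳ-re (re x) (im x) (re y) (im y) (re z) (im z) dℚ)
                                           (·-distribʳ-im (re x) (im x) (re y) (im y) (re z) (im z)))
      }
    ; *-comm = λ x y → cong₂ _+_√ (·-comm-re (re x) (im x) (re y) (im y) dℚ) (·-comm-im (re x) (im x) (re y) (im y))
    }

  K-commutativeRing : CommutativeRing 0ℓ 0ℓ
  K-commutativeRing = record { isCommutativeRing = K-isCommutativeRing }

  open CommutativeRing K-commutativeRing using (zeroˡ; commutativeSemiring; +-group)
    renaming (+-identityʳ to ⊕-identityʳ; *-identityˡ to ·-identityˡ; *-identityʳ to ·-identityʳ)
  open CommutativeSemiringExp commutativeSemiring using (_^_; ^-distrib-*)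
  open NaturalCoefficientsSolver commutativeSemiring using (solve; _:=_; _:+_; _:*_)
  open GroupProperties +-group using (inverseˡ-unique)

  •-distrib-· : ∀ c e x y → (c ℚ.* e) • (x · y) ≡ (c • x) · (e • y)
  •-distrib-· c e x y = cong₂ _+_√ (scale-re c e (re x) (im x) (re y) (im y) dℚ) (scale-im c e (re x) (im x) (re y) (im y))
    where
    scale-re : ∀ c e p q r s D → (c ℚ.* e) ℚ.* (p ℚ.* r ℚ.+ D ℚ.* (q ℚ.* s))
                                ≡ (c ℚ.* p) ℚ.* (e ℚ.* r) ℚ.+ D ℚ.* ((c ℚ.* q) ℚ.* (e ℚ.* s))
    scale-re = Solver.solve-∀ ℚ-ring
    scale-im : ∀ c e p q r s → (c ℚ.* e) ℚ.* (p ℚ.* s ℚ.+ q ℚ.* r)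
                              ≡ (c ℚ.* p) ℚ.* (e ℚ.* s) ℚ.+ (c ℚ.* q) ℚ.* (e ℚ.* r)
    scale-im = Solver.solve-∀ ℚ-ring

  •≡fromℚK· : ∀ c x → c • x ≡ fromℚK c · x
  •≡fromℚK· c x = cong₂ _+_√ (sym (embed-re c (re x) (im x) dℚ)) (sym (embed-im c (re x) (im x)))
    where
    embed-re : ∀ c p q D → c ℚ.* p ℚ.+ D ℚ.* (0ℚ ℚ.* q) ≡ c ℚ.* p
    embed-re = Solver.solve-∀ ℚ-ring
    embed-im : ∀ c p q → c ℚ.* q ℚ.+ 0ℚ ℚ.* p ≡ c ℚ.* q
    embed-im = Solver.solve-∀ ℚ-ring

  fromℚK-homo-* : ∀ c e → fromℚK (c ℚ.* e) ≡ fromℚK c · fromℚK e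
  fromℚK-homo-* c e = cong₂ _+_√ (sym (product-re c e dℚ)) (sym (product-im c e))
    where
    product-re : ∀ c e D → c ℚ.* e ℚ.+ D ℚ.* (0ℚ ℚ.* 0ℚ) ≡ c ℚ.* e
    product-re = Solver.solve-∀ ℚ-ring
    product-im : ∀ c e → c ℚ.* 0ℚ ℚ.+ 0ℚ ℚ.* e ≡ 0ℚ
    product-im = Solver.solve-∀ ℚ-ring

  fromℚK-^ : ∀ c k → fromℚK c ^ k ≡ fromℚK (c ^ℚ k)
  fromℚK-^ c zero    = refl
  fromℚK-^ c (suc k) = trans (cong (fromℚK c ·_) (fromℚK-^ c k)) (sym (fromℚK-homo-* c (c ^ℚ k)))

  conj-homo-· : ∀ x y → conj (x · y) ≡ conj x · conj y
  conj-homo-· x y = cong₂ _+_√ (conj-re (re x) (im x) (re y) (im y) dℚ) (conj-im (re x) (im x) (re y) (im y))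
    where
    conj-re : ∀ p q r s D → p ℚ.* r ℚ.+ D ℚ.* (q ℚ.* s) ≡ p ℚ.* r ℚ.+ D ℚ.* (ℚ.- q ℚ.* ℚ.- s)
    conj-re = Solver.solve-∀ ℚ-ring
    conj-im : ∀ p q r s → ℚ.- (p ℚ.* s ℚ.+ q ℚ.* r) ≡ p ℚ.* ℚ.- s ℚ.+ ℚ.- q ℚ.* r
    conj-im = Solver.solve-∀ ℚ-ring

  conj-^ : ∀ x k → conj x ^ k ≡ conj (x ^ k)
  conj-^ x zero    = refl
  conj-^ x (suc k) = trans (cong (conj x ·_) (conj-^ x k)) (sym (conj-homo-· x (x ^ k)))

  IntegralCoords-· : ∀ {x y} → IntegralCoords x → IntegralCoords y → IntegralCoords (x · y)
  IntegralCoords-· (p , q) (r , s) = Integral-+ (Integral-* p r) (Integral-* (Integral-ι (+ d)) (Integral-* q s))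
                                   , Integral-+ (Integral-* p s) (Integral-* q r)

  IntegralCoords-^ : ∀ {x} → IntegralCoords x → ∀ k → IntegralCoords (x ^ k)
  IntegralCoords-^ _  zero    = Integral-ι (+ 1) , Integral-ι (+ 0)
  IntegralCoords-^ ix (suc k) = IntegralCoords-· ix (IntegralCoords-^ ix k)

  HasDenominator-· : ∀ {D E x y} → HasDenominator D x → HasDenominator E y → HasDenominator (D * E) (x · y)
  HasDenominator-· {D} {E} {x} {y} (hasDenominator Dx) (hasDenominator Ey) = hasDenominator (subst IntegralCoords
    (sym (trans (cong (_• (x · y)) (ℕtoℚ-homo-* D E)) (•-distrib-· (ℕtoℚ D) (ℕtoℚ E) x y)))
    (IntegralCoords-· Dx Ey))

  BoundedPowers : K → Set
  BoundedPowers x = ∃[ D ] NonZero D × (∀ k → HasDenominator D (x ^ k))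

  IntegralCoords⇒BoundedPowers : ∀ {x} → IntegralCoords x → BoundedPowers x
  IntegralCoords⇒BoundedPowers ix = 1 , _ , λ k → IntegralCoords⇒HasDenominator-1 (IntegralCoords-^ ix k)

  BoundedPowers-· : ∀ {x y} → BoundedPowers x → BoundedPowers y → BoundedPowers (x · y)
  BoundedPowers-· {x} {y} (D , D≢0 , Dx^) (E , E≢0 , Ey^) = D * E , ℕP.m*n≢0 D E {{D≢0}} {{E≢0}} ,
    λ k → subst (HasDenominator (D * E)) (sym (^-distrib-* x y k)) (HasDenominator-· (Dx^ k) (Ey^ k))

  -- All x^i y^j (x + y)^k have the denominator D E: induct on k, splitting off one factor x + y.
  BoundedPowers-⊕ : ∀ {x y} → BoundedPowers x → BoundedPowers y → BoundedPowers (x ⊕ y)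
  BoundedPowers-⊕ {x} {y} (D , D≢0 , Dx^) (E , E≢0 , Ey^) = D * E , ℕP.m*n≢0 D E {{D≢0}} {{E≢0}} ,
    λ k → subst (HasDenominator (D * E)) (mixed-0-0 k) (mixed-denominator k 0 0)
    where
    mixed : ℕ → ℕ → ℕ → K
    mixed i j k = ((x ^ i) · (y ^ j)) · ((x ⊕ y) ^ k)

    mixed-suc : ∀ i j k → mixed i j (suc k) ≡ mixed (suc i) j k ⊕ mixed i (suc j) k
    mixed-suc i j k = solve 5 (λ x y X Y S → (X :* Y) :* ((x :+ y) :* S) := ((x :* X) :* Y) :* S :+ (X :* (y :* Y)) :* S)
                              refl x y (x ^ i) (y ^ j) ((x ⊕ y) ^ k)

    mixed-0-0 : ∀ k → mixed 0 0 k ≡ (x ⊕ y) ^ k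
    mixed-0-0 k = trans (cong (_· ((x ⊕ y) ^ k)) (·-identityˡ 1K)) (·-identityˡ ((x ⊕ y) ^ k))

    mixed-denominator : ∀ k i j → HasDenominator (D * E) (mixed i j k)
    mixed-denominator zero    i j = subst (HasDenominator (D * E)) (sym (·-identityʳ _)) (HasDenominator-· (Dx^ i) (Ey^ j))
    mixed-denominator (suc k) i j = subst (HasDenominator (D * E)) (sym (mixed-suc i j k))
      (HasDenominator-⊕ (mixed-denominator k (suc i) j) (mixed-denominator k i (suc j)))

  BoundedPowers-conj : ∀ {x} → BoundedPowers x → BoundedPowers (conj x)
  BoundedPowers-conj {x} (D , D≢0 , Dx^) = D , D≢0 , λ k → subst (HasDenominator D) (sym (conj-^ x k)) (HasDenominator-conj (Dx^ k))

  BoundedPowers-• : ∀ {c x} → Integral c → BoundedPowers x → BoundedPowers (c • x)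
  BoundedPowers-• {c} {x} c∈ℤ bx = subst BoundedPowers (sym (•≡fromℚK· c x))
    (BoundedPowers-· (IntegralCoords⇒BoundedPowers (c∈ℤ , Integral-ι (+ 0))) bx)

  BoundedPowers-fromℚK⇒Integral : ∀ {c} → BoundedPowers (fromℚK c) → Integral c
  BoundedPowers-fromℚK⇒Integral {c} (D , D≢0 , Dc^) =
    bounded-powers⇒integral c D {{D≢0}} λ k → proj₁ (HasDenominator.clears (subst (HasDenominator D) (fromℚK-^ c k) (Dc^ k)))

  hornerTail : K → ℕ → List ℤ → K
  hornerTail x j []       = 0K
  hornerTail x j (c ∷ cs) = (fromℤK c · (x ^ (length cs ℕ.+ j))) ⊕ hornerTail x j cs

  hornerLoop-·^ : ∀ cs₀ x cs acc j →
                  hornerLoop d cs₀ x cs acc · (x ^ j) ≡ (acc · (x ^ (length cs ℕ.+ j))) ⊕ hornerTail x j cs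
  hornerLoop-·^ cs₀ x []       acc j = sym (⊕-identityʳ _)
  hornerLoop-·^ cs₀ x (c ∷ cs) acc j = trans (hornerLoop-·^ cs₀ x cs (acc · x ⊕ fromℤK c) j)
    (solve 5 (λ acc x c X T → (acc :* x :+ c) :* X :+ T := acc :* (x :* X) :+ (c :* X :+ T))
             refl acc x (fromℤK c) (x ^ (length cs ℕ.+ j)) (hornerTail x j cs))

  power-reduction : ∀ {x} cs → hornerMonic d cs x ≡ 0K → ∀ j → x ^ (length cs ℕ.+ j) ≡ negK (hornerTail x j cs)
  power-reduction {x} cs root j = inverseˡ-unique _ _ (begin
    (x ^ (length cs ℕ.+ j)) ⊕ hornerTail x j cs           ≡⟨ cong (_⊕ hornerTail x j cs) (·-identityˡ (x ^ (length cs ℕ.+ j))) ⟨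
    (1K · (x ^ (length cs ℕ.+ j))) ⊕ hornerTail x j cs    ≡⟨ hornerLoop-·^ cs x cs 1K j ⟨
    hornerMonic d cs x · (x ^ j)                           ≡⟨ cong (_· (x ^ j)) root ⟩
    0K · (x ^ j)                                           ≡⟨ zeroˡ (x ^ j) ⟩
    0K                                                     ∎)
    where open ≡-Reasoning

  hornerTail-denominator : ∀ {D x} j cs → (∀ i → i < length cs → HasDenominator D (x ^ (i ℕ.+ j))) →
                           HasDenominator D (hornerTail x j cs)
  hornerTail-denominator {D} j []       _       = HasDenominator-0K D
  hornerTail-denominator {D} j (c ∷ cs) earlier = HasDenominator-⊕
    (subst (HasDenominator D) (•≡fromℚK· (ι c) _) (HasDenominator-• (Integral-ι c) (earlier (length cs) (ℕP.n<1+n _))))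
    (hornerTail-denominator j cs λ i i<L → earlier i (ℕP.m<n⇒m<1+n i<L))

  initial-powers-denominator : ∀ x n → ∃[ D ] NonZero D × (∀ i → i < n → HasDenominator D (x ^ i))
  initial-powers-denominator x zero    = 1 , _ , λ _ ()
  initial-powers-denominator x (suc n) with initial-powers-denominator x n
  ... | D , D≢0 , below-n = D * E , ℕP.m*n≢0 D E {{D≢0}} , below-1+n
    where
    E = ↧ₙ (re (x ^ n)) * ↧ₙ (im (x ^ n))
    below-1+n : ∀ i → i < suc n → HasDenominator (D * E) (x ^ i)
    below-1+n i i<1+n with i ℕP.≟ n
    ... | yes refl = HasDenominator-*ˡ D (denominator (x ^ n))
    ... | no  i≢n  = HasDenominator-*ʳ E (below-n i (ℕP.≤∧≢⇒< (ℕP.≤-pred i<1+n) i≢n))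

  -- Beyond the degree L of the monic relation, x^(L+j) is a ℤ-combination of lower powers.
  IsAlgInt⇒BoundedPowers : ∀ {x} → IsAlgInt d x → BoundedPowers x
  IsAlgInt⇒BoundedPowers {x} (cs , root) with initial-powers-denominator x (length cs)
  ... | D , D≢0 , initial = D , D≢0 , <-rec (λ k → HasDenominator D (x ^ k)) step
    where
    step : ∀ k → (∀ {i} → i < k → HasDenominator D (x ^ i)) → HasDenominator D (x ^ k)
    step k earlier with k ℕ.<? length cs
    ... | yes k<L = initial k k<L
    ... | no  k≮L = subst (λ t → HasDenominator D (x ^ t)) L+j≡k
      (subst (HasDenominator D) (sym (power-reduction cs root j))
        (HasDenominator-negK (hornerTail-denominator j cs λ i i<L →
          earlier (subst (i ℕ.+ j <_) L+j≡k (ℕP.+-monoˡ-< j i<L)))))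
      where
      j = k ℕ.∸ length cs
      L+j≡k : length cs ℕ.+ j ≡ k
      L+j≡k = ℕP.m+[n∸m]≡n (ℕP.≮⇒≥ k≮L)

  -- x = p + q√d is a root of X² − 2p X + (p² − d q²).
  BoundedPowers⇒IsAlgInt : ∀ {x} → BoundedPowers x → IsAlgInt d x
  BoundedPowers⇒IsAlgInt {p + q √} bounded = (ℤ.- t ∷ n ∷ []) , (begin
      hornerMonic d (ℤ.- t ∷ n ∷ []) x
    ≡⟨ cong₂ (λ c₁ c₂ → ((1K · x ⊕ fromℚK c₁) · x) ⊕ fromℚK c₂) (trans (ι-homo‿- t) (cong ℚ.-_ (sym t≡))) (sym n≡) ⟩
      ((1K · x ⊕ fromℚK (ℚ.- trace)) · x) ⊕ fromℚK norm
    ≡⟨ cong₂ _+_√ (root-re p q dℚ) (root-im p q dℚ) ⟩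
      0K ∎)
    where
    open ≡-Reasoning
    x = p + q √
    trace = p ℚ.+ p
    norm = p ℚ.* p ℚ.+ dℚ ℚ.* (q ℚ.* ℚ.- q)
    norm-im : ∀ p q → p ℚ.* ℚ.- q ℚ.+ q ℚ.* p ≡ 0ℚ
    norm-im = Solver.solve-∀ ℚ-ring
    root-re : ∀ p q d → ((1ℚ ℚ.* p ℚ.+ d ℚ.* (0ℚ ℚ.* q)) ℚ.+ ℚ.- (p ℚ.+ p)) ℚ.* p
                        ℚ.+ d ℚ.* ((1ℚ ℚ.* q ℚ.+ 0ℚ ℚ.* p ℚ.+ 0ℚ) ℚ.* q)
                        ℚ.+ (p ℚ.* p ℚ.+ d ℚ.* (q ℚ.* ℚ.- q)) ≡ 0ℚ
    root-re = Solver.solve-∀ ℚ-ring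
    root-im : ∀ p q d → ((1ℚ ℚ.* p ℚ.+ d ℚ.* (0ℚ ℚ.* q)) ℚ.+ ℚ.- (p ℚ.+ p)) ℚ.* q
                        ℚ.+ (1ℚ ℚ.* q ℚ.+ 0ℚ ℚ.* p ℚ.+ 0ℚ) ℚ.* p ℚ.+ 0ℚ ≡ 0ℚ
    root-im = Solver.solve-∀ ℚ-ring
    trace∈ℤ : Integral trace
    trace∈ℤ = BoundedPowers-fromℚK⇒Integral (subst BoundedPowers (cong₂ _+_√ refl (ℚP.+-inverseʳ q))
                (BoundedPowers-⊕ bounded (BoundedPowers-conj bounded)))
    norm∈ℤ : Integral norm
    norm∈ℤ = BoundedPowers-fromℚK⇒Integral (subst BoundedPowers (cong₂ _+_√ refl (norm-im p q))
               (BoundedPowers-· bounded (BoundedPowers-conj bounded)))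
    t = proj₁ trace∈ℤ
    t≡ = proj₂ trace∈ℤ
    n = proj₁ norm∈ℤ
    n≡ = proj₂ norm∈ℤ

  IntegralCoords⇒IsAlgInt : ∀ {x} → IntegralCoords x → IsAlgInt d x
  IntegralCoords⇒IsAlgInt ix = BoundedPowers⇒IsAlgInt (IntegralCoords⇒BoundedPowers ix)

  IsAlgInt-ℤ-combination : ∀ {m n x y} → Integral m → Integral n → IsAlgInt d x → IsAlgInt d y →
                           IsAlgInt d ((m • x) ⊕ (n • y))
  IsAlgInt-ℤ-combination m∈ℤ n∈ℤ x∈𝔒 y∈𝔒 = BoundedPowers⇒IsAlgInt
    (BoundedPowers-⊕ (BoundedPowers-• m∈ℤ (IsAlgInt⇒BoundedPowers x∈𝔒)) (BoundedPowers-• n∈ℤ (IsAlgInt⇒BoundedPowers y∈𝔒)))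

  ⊕-rotate : ∀ x y z → (x ⊕ y) ⊕ z ≡ (y ⊕ z) ⊕ x
  ⊕-rotate = solve 3 (λ x y z → x :+ y :+ z := y :+ z :+ x) refl

module IntegralBasisCoordinates (d : ℕ) {β₁ β₂ : K} (basis : IsIntegralBasis d β₁ β₂) where
  open QuadraticField d
  open GroupProperties ℚP.+-0-group using (x∙y⁻¹≈ε⇒x≈y)

  β₁∈𝔒 : IsAlgInt d β₁
  β₁∈𝔒 = proj₁ basis

  β₂∈𝔒 : IsAlgInt d β₂
  β₂∈𝔒 = proj₁ (proj₂ basis)

  ℤ-coordinates-unique : ∀ {γ k₁ k₂ l₁ l₂} → IsAlgInt d γ →
                         γ ≡ (ι k₁ • β₁) ⊕ (ι k₂ • β₂) → γ ≡ (ι l₁ • β₁) ⊕ (ι l₂ • β₂) → k₁ ≡ l₁ × k₂ ≡ l₂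
  ℤ-coordinates-unique {γ} {k₁} {k₂} {l₁} {l₂} γ∈𝔒 γ≡k γ≡l = trans k₁≡m₁ (sym l₁≡m₁) , trans k₂≡m₂ (sym l₂≡m₂)
    where
    unique = proj₂ (proj₂ (proj₂ (proj₂ (proj₂ basis) γ γ∈𝔒)))
    k₁≡m₁ = proj₁ (unique k₁ k₂ γ≡k)
    k₂≡m₂ = proj₂ (unique k₁ k₂ γ≡k)
    l₁≡m₁ = proj₁ (unique l₁ l₂ γ≡l)
    l₂≡m₂ = proj₂ (unique l₁ l₂ γ≡l)

  ℚ-linearly-independent : ∀ r₁ r₂ → (r₁ • β₁) ⊕ (r₂ • β₂) ≡ 0K → r₁ ≡ 0ℚ × r₂ ≡ 0ℚ
  ℚ-linearly-independent r₁ r₂ r•β≡0 = vanishes (proj₂ (proj₁ cleared)) (proj₁ k≡0)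
                                     , vanishes (proj₂ (proj₂ cleared)) (proj₂ k≡0)
    where
    open ≡-Reasoning
    E = ↧ₙ r₁ * ↧ₙ r₂
    cleared = common-denominator r₁ r₂
    k₁ = proj₁ (proj₁ cleared)
    k₂ = proj₁ (proj₂ cleared)
    0≡k•β : 0K ≡ (ι k₁ • β₁) ⊕ (ι k₂ • β₂)
    0≡k•β = begin
      0K                                                  ≡⟨ cong₂ _+_√ (ℚP.*-zeroʳ (ℕtoℚ E)) (ℚP.*-zeroʳ (ℕtoℚ E)) ⟨
      ℕtoℚ E • 0K                                         ≡⟨ cong (ℕtoℚ E •_) r•β≡0 ⟨
      ℕtoℚ E • ((r₁ • β₁) ⊕ (r₂ • β₂))                    ≡⟨ •-distrib-⊕ (ℕtoℚ E) (r₁ • β₁) (r₂ • β₂) ⟩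
      (ℕtoℚ E • (r₁ • β₁)) ⊕ (ℕtoℚ E • (r₂ • β₂))         ≡⟨ cong₂ _⊕_ (•-assoc (ℕtoℚ E) r₁ β₁) (•-assoc (ℕtoℚ E) r₂ β₂) ⟩
      ((ℕtoℚ E ℚ.* r₁) • β₁) ⊕ ((ℕtoℚ E ℚ.* r₂) • β₂)     ≡⟨ cong₂ (λ u v → (u • β₁) ⊕ (v • β₂)) (proj₂ (proj₁ cleared)) (proj₂ (proj₂ cleared)) ⟩
      (ι k₁ • β₁) ⊕ (ι k₂ • β₂)                           ∎
    0≡0•β : 0K ≡ (ι (+ 0) • β₁) ⊕ (ι (+ 0) • β₂)
    0≡0•β = sym (cong₂ _+_√ (zero-combination (re β₁) (re β₂)) (zero-combination (im β₁) (im β₂)))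
      where
      zero-combination : ∀ p q → 0ℚ ℚ.* p ℚ.+ 0ℚ ℚ.* q ≡ 0ℚ
      zero-combination = Solver.solve-∀ ℚ-ring
    k≡0 : k₁ ≡ + 0 × k₂ ≡ + 0
    k≡0 = ℤ-coordinates-unique (IntegralCoords⇒IsAlgInt (Integral-ι (+ 0) , Integral-ι (+ 0))) 0≡k•β 0≡0•β
    vanishes : ∀ {r k} → ℕtoℚ E ℚ.* r ≡ ι k → k ≡ + 0 → r ≡ 0ℚ
    vanishes {r} Er≡k refl = *-cancelʳ-≡ (ℕtoℚ E) {{ℕtoℚ-nonZero E {{ℕP.m*n≢0 (↧ₙ r₁) (↧ₙ r₂)}}}}
      (trans (ℚP.*-comm r (ℕtoℚ E)) (trans Er≡k (sym (ℚP.*-zeroˡ (ℕtoℚ E)))))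

  ℚ-coordinates-unique : ∀ {s₁ s₂ t₁ t₂} → (s₁ • β₁) ⊕ (s₂ • β₂) ≡ (t₁ • β₁) ⊕ (t₂ • β₂) → s₁ ≡ t₁ × s₂ ≡ t₂
  ℚ-coordinates-unique {s₁} {s₂} {t₁} {t₂} s•β≡t•β =
    x∙y⁻¹≈ε⇒x≈y s₁ t₁ (proj₁ difference≡0) , x∙y⁻¹≈ε⇒x≈y s₂ t₂ (proj₂ difference≡0)
    where
    t•β = (t₁ • β₁) ⊕ (t₂ • β₂)
    difference : ∀ s₁ s₂ t₁ t₂ p₁ p₂ → (s₁ ℚ.- t₁) ℚ.* p₁ ℚ.+ (s₂ ℚ.- t₂) ℚ.* p₂
                                      ≡ (s₁ ℚ.* p₁ ℚ.+ s₂ ℚ.* p₂) ℚ.- (t₁ ℚ.* p₁ ℚ.+ t₂ ℚ.* p₂)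
    difference = Solver.solve-∀ ℚ-ring
    difference≡0 = ℚ-linearly-independent (s₁ ℚ.- t₁) (s₂ ℚ.- t₂) (begin
      ((s₁ ℚ.- t₁) • β₁) ⊕ ((s₂ ℚ.- t₂) • β₂)
        ≡⟨ cong₂ _+_√ (difference s₁ s₂ t₁ t₂ (re β₁) (re β₂)) (difference s₁ s₂ t₁ t₂ (im β₁) (im β₂)) ⟩
      ((s₁ • β₁) ⊕ (s₂ • β₂)) ⊖ t•β
        ≡⟨ cong (_⊖ t•β) s•β≡t•β ⟩
      t•β ⊖ t•β
        ≡⟨ cong₂ _+_√ (ℚP.+-inverseʳ (re t•β)) (ℚP.+-inverseʳ (im t•β)) ⟩
      0K ∎)
      where open ≡-Reasoning

module ConeOverIntegralBasis (d : ℕ) {β₁ β₂ : K} (basis : IsIntegralBasis d β₁ β₂)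
                             (a b : ℕ) .{{_ : NonZero a}} {α : K} (α≡ : α ≡ ((a * b) ·ℕ β₂) ⊖ (a ·ℕ β₁)) where
  open QuadraticField d
  open IntegralBasisCoordinates d basis

  α-in-basis : ∀ r s₁ s₂ → ((r • α) ⊕ (s₁ • β₁)) ⊕ (s₂ • β₂)
                          ≡ ((s₁ ℚ.- r ℚ.* ℕtoℚ a) • β₁) ⊕ ((s₂ ℚ.+ r ℚ.* ℕtoℚ (a * b)) • β₂)
  α-in-basis r s₁ s₂ = trans (cong (λ α → ((r • α) ⊕ (s₁ • β₁)) ⊕ (s₂ • β₂)) α≡)
    (cong₂ _+_√ (expand r s₁ s₂ (ℕtoℚ a) (ℕtoℚ (a * b)) (re β₁) (re β₂))
                (expand r s₁ s₂ (ℕtoℚ a) (ℕtoℚ (a * b)) (im β₁) (im β₂)))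
    where
    expand : ∀ r s₁ s₂ A₁ A₂ p₁ p₂ → r ℚ.* (A₂ ℚ.* p₂ ℚ.- A₁ ℚ.* p₁) ℚ.+ s₁ ℚ.* p₁ ℚ.+ s₂ ℚ.* p₂
                                     ≡ (s₁ ℚ.- r ℚ.* A₁) ℚ.* p₁ ℚ.+ (s₂ ℚ.+ r ℚ.* A₂) ℚ.* p₂
    expand = Solver.solve-∀ ℚ-ring

  Representable : K → Set
  Representable γ = ∃[ n ] ∃[ n₁ ] ∃[ n₂ ] (γ ≡ ((((+ n) / a) • α) ⊕ (n₁ ·ℕ β₁)) ⊕ (n₂ ·ℕ β₂))

  representation-in-basis : ∀ n n₁ n₂ → ((((+ n) / a) • α) ⊕ (n₁ ·ℕ β₁)) ⊕ (n₂ ·ℕ β₂)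
                                      ≡ ((ℕtoℚ n₁ ℚ.- ℕtoℚ n) • β₁) ⊕ ((ℕtoℚ n₂ ℚ.+ ℕtoℚ n ℚ.* ℕtoℚ b) • β₂)
  representation-in-basis n n₁ n₂ = trans (α-in-basis ((+ n) / a) (ℕtoℚ n₁) (ℕtoℚ n₂))
    (cong₂ (λ u v → ((ℕtoℚ n₁ ℚ.- u) • β₁) ⊕ ((ℕtoℚ n₂ ℚ.+ v) • β₂)) (n/a*a≡n n a) n/a*ab≡nb)
    where
    n/a*ab≡nb : ((+ n) / a) ℚ.* ℕtoℚ (a * b) ≡ ℕtoℚ n ℚ.* ℕtoℚ b
    n/a*ab≡nb = trans (cong (((+ n) / a) ℚ.*_) (ℕtoℚ-homo-* a b))
                (trans (sym (ℚP.*-assoc ((+ n) / a) (ℕtoℚ a) (ℕtoℚ b))) (cong (ℚ._* ℕtoℚ b) (n/a*a≡n n a)))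

  Representable⇒IsAlgInt : ∀ {γ} → Representable γ → IsAlgInt d γ
  Representable⇒IsAlgInt (n , n₁ , n₂ , γ≡) = subst (IsAlgInt d) (sym (trans γ≡ (representation-in-basis n n₁ n₂)))
    (IsAlgInt-ℤ-combination (Integral-+ (Integral-ι (+ n₁)) (Integral-neg (Integral-ι (+ n))))
                            (Integral-+ (Integral-ι (+ n₂)) (Integral-* (Integral-ι (+ n)) (Integral-ι (+ b))))
                            β₁∈𝔒 β₂∈𝔒)

  Representable⇒InConeℚ : ∀ {γ} → Representable γ → InConeℚ β₁ β₂ α γ
  Representable⇒InConeℚ (n , n₁ , n₂ , γ≡) =
    ℕtoℚ n₁ , ℕtoℚ n₂ , (+ n) / a , 0≤n/a n₁ 1 , 0≤n/a n₂ 1 , 0≤n/a n a ,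
    trans γ≡ (⊕-rotate (((+ n) / a) • α) (n₁ ·ℕ β₁) (n₂ ·ℕ β₂))

  coordinates⇒Representable : ∀ {γ} m₁ M → γ ≡ (ι m₁ • β₁) ⊕ (ℕtoℚ M • β₂) →
                              0ℚ ℚ.≤ ℕtoℚ b ℚ.* ι m₁ ℚ.+ ℕtoℚ M → Representable γ
  coordinates⇒Representable (+ k) M γ≡ _ = 0 , k , M , trans γ≡ (sym (trans (representation-in-basis 0 k M)
    (cong₂ (λ u v → (u • β₁) ⊕ (v • β₂)) (ℚP.+-identityʳ (ℕtoℚ k)) (trans (cong (ℕtoℚ M ℚ.+_) (ℚP.*-zeroˡ (ℕtoℚ b))) (ℚP.+-identityʳ (ℕtoℚ M))))))
  coordinates⇒Representable -[1+ k ] M γ≡ 0≤b*m₁+M = suc k , 0 , M ℕ.∸ P , trans γ≡ (sym (trans (representation-in-basis (suc k) 0 (M ℕ.∸ P))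
    (cong₂ (λ u v → (u • β₁) ⊕ (v • β₂)) 0-[1+k]≡m₁ [M∸P]+P≡M)))
    where
    P = suc k * b
    0-[1+k]≡m₁ : ℕtoℚ 0 ℚ.- ℕtoℚ (suc k) ≡ ι -[1+ k ]
    0-[1+k]≡m₁ = trans (ℚP.+-identityˡ _) (sym (ι-homo‿- (+ suc k)))
    M-P≥0 : 0ℚ ℚ.≤ ℕtoℚ M ℚ.- ℕtoℚ P
    M-P≥0 = subst (0ℚ ℚ.≤_) (begin
      ℕtoℚ b ℚ.* ι -[1+ k ] ℚ.+ ℕtoℚ M              ≡⟨ cong (λ t → ℕtoℚ b ℚ.* t ℚ.+ ℕtoℚ M) (ι-homo‿- (+ suc k)) ⟩
      ℕtoℚ b ℚ.* ℚ.- ℕtoℚ (suc k) ℚ.+ ℕtoℚ M        ≡⟨ rearrange (ℕtoℚ b) (ℕtoℚ (suc k)) (ℕtoℚ M) ⟩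
      ℕtoℚ M ℚ.- ℕtoℚ (suc k) ℚ.* ℕtoℚ b            ≡⟨ cong (λ t → ℕtoℚ M ℚ.- t) (ℕtoℚ-homo-* (suc k) b) ⟨
      ℕtoℚ M ℚ.- ℕtoℚ P                             ∎) 0≤b*m₁+M
      where
      open ≡-Reasoning
      rearrange : ∀ b k M → b ℚ.* ℚ.- k ℚ.+ M ≡ M ℚ.- k ℚ.* b
      rearrange = Solver.solve-∀ ℚ-ring
    P≤M : P ≤ M
    P≤M = ℤP.drop‿+≤+ (ι-cancel-≤ (subst₂ ℚ._≤_ (ℚP.+-identityˡ (ℕtoℚ P)) (cancel (ℕtoℚ M) (ℕtoℚ P)) (ℚP.+-monoˡ-≤ (ℕtoℚ P) M-P≥0)))
      where
      cancel : ∀ M P → (M ℚ.- P) ℚ.+ P ≡ M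
      cancel = Solver.solve-∀ ℚ-ring
    [M∸P]+P≡M : ℕtoℚ (M ℕ.∸ P) ℚ.+ ℕtoℚ (suc k) ℚ.* ℕtoℚ b ≡ ℕtoℚ M
    [M∸P]+P≡M = trans (cong (ℕtoℚ (M ℕ.∸ P) ℚ.+_) (sym (ℕtoℚ-homo-* (suc k) b)))
                (trans (sym (ℕtoℚ-homo-+ (M ℕ.∸ P) P)) (cong ℕtoℚ (ℕP.m∸n+n≡m P≤M)))

  InConeℚ∩𝔒⇒Representable : ∀ {γ} → InConeℚ β₁ β₂ α γ × IsAlgInt d γ → Representable γ
  InConeℚ∩𝔒⇒Representable {γ} ((q₁ , q₂ , q₃ , 0≤q₁ , 0≤q₂ , 0≤q₃ , γ≡q) , γ∈𝔒) =
    coordinates⇒Representable m₁ ℤ.∣ m₂ ∣ γ≡m′ 0≤b*m₁+∣m₂∣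
    where
    open ≡-Reasoning
    ℤ-coordinates = proj₂ (proj₂ basis) γ γ∈𝔒
    m₁ = proj₁ ℤ-coordinates
    m₂ = proj₁ (proj₂ ℤ-coordinates)
    γ≡m : γ ≡ (ι m₁ • β₁) ⊕ (ι m₂ • β₂)
    γ≡m = proj₁ (proj₂ (proj₂ ℤ-coordinates))
    m≡q : ι m₁ ≡ q₁ ℚ.- q₃ ℚ.* ℕtoℚ a × ι m₂ ≡ q₂ ℚ.+ q₃ ℚ.* ℕtoℚ (a * b)
    m≡q = ℚ-coordinates-unique (trans (sym γ≡m) (trans γ≡q (trans (sym (⊕-rotate (q₃ • α) (q₁ • β₁) (q₂ • β₂))) (α-in-basis q₃ q₁ q₂))))
    0≤m₂ : 0ℚ ℚ.≤ ι m₂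
    0≤m₂ = subst (0ℚ ℚ.≤_) (sym (proj₂ m≡q)) (0≤+ 0≤q₂ (0≤* 0≤q₃ (0≤n/a (a * b) 1)))
    ∣m₂∣≡m₂ : ℕtoℚ ℤ.∣ m₂ ∣ ≡ ι m₂
    ∣m₂∣≡m₂ = cong ι (ℤP.0≤i⇒+∣i∣≡i (ι-cancel-≤ {+ 0} {m₂} 0≤m₂))
    γ≡m′ : γ ≡ (ι m₁ • β₁) ⊕ (ℕtoℚ ℤ.∣ m₂ ∣ • β₂)
    γ≡m′ = trans γ≡m (cong (λ t → (ι m₁ • β₁) ⊕ (t • β₂)) (sym ∣m₂∣≡m₂))
    cancel-α : ∀ b q₁ q₂ q₃ a → b ℚ.* (q₁ ℚ.- q₃ ℚ.* a) ℚ.+ (q₂ ℚ.+ q₃ ℚ.* (a ℚ.* b)) ≡ b ℚ.* q₁ ℚ.+ q₂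
    cancel-α = Solver.solve-∀ ℚ-ring
    0≤b*m₁+∣m₂∣ : 0ℚ ℚ.≤ ℕtoℚ b ℚ.* ι m₁ ℚ.+ ℕtoℚ ℤ.∣ m₂ ∣
    0≤b*m₁+∣m₂∣ = subst (0ℚ ℚ.≤_) (sym (begin
      ℕtoℚ b ℚ.* ι m₁ ℚ.+ ℕtoℚ ℤ.∣ m₂ ∣
        ≡⟨ cong₂ (λ u v → ℕtoℚ b ℚ.* u ℚ.+ v) (proj₁ m≡q) (trans ∣m₂∣≡m₂ (proj₂ m≡q)) ⟩
      ℕtoℚ b ℚ.* (q₁ ℚ.- q₃ ℚ.* ℕtoℚ a) ℚ.+ (q₂ ℚ.+ q₃ ℚ.* ℕtoℚ (a * b))
        ≡⟨ cong (λ t → ℕtoℚ b ℚ.* (q₁ ℚ.- q₃ ℚ.* ℕtoℚ a) ℚ.+ (q₂ ℚ.+ q₃ ℚ.* t)) (ℕtoℚ-homo-* a b) ⟩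
      ℕtoℚ b ℚ.* (q₁ ℚ.- q₃ ℚ.* ℕtoℚ a) ℚ.+ (q₂ ℚ.+ q₃ ℚ.* (ℕtoℚ a ℚ.* ℕtoℚ b))
        ≡⟨ cancel-α (ℕtoℚ b) q₁ q₂ q₃ (ℕtoℚ a) ⟩
      ℕtoℚ b ℚ.* q₁ ℚ.+ q₂ ∎))
      (0≤+ (0≤* (0≤n/a b 1) 0≤q₁) 0≤q₂)

  n·ℕ[α/a]≡[n/a]•α : ∀ n → n ·ℕ (((+ 1) / a) • α) ≡ ((+ n) / a) • α
  n·ℕ[α/a]≡[n/a]•α n = trans (•-assoc (ℕtoℚ n) ((+ 1) / a) α) (cong (_• α) (n*[1/a]≡n/a n a))

  Representable⇒InSG : ∀ {γ} → Representable γ → InSG β₁ β₂ (((+ 1) / a) • α) γ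
  Representable⇒InSG (n , n₁ , n₂ , γ≡) = n₁ , n₂ , n ,
    trans γ≡ (trans (⊕-rotate (((+ n) / a) • α) (n₁ ·ℕ β₁) (n₂ ·ℕ β₂)) (cong (((n₁ ·ℕ β₁) ⊕ (n₂ ·ℕ β₂)) ⊕_) (sym (n·ℕ[α/a]≡[n/a]•α n))))

  InSG⇒Representable : ∀ {γ} → InSG β₁ β₂ (((+ 1) / a) • α) γ → Representable γ
  InSG⇒Representable (n₁ , n₂ , n , γ≡) = n , n₁ , n₂ ,
    trans γ≡ (trans (cong (((n₁ ·ℕ β₁) ⊕ (n₂ ·ℕ β₂)) ⊕_) (n·ℕ[α/a]≡[n/a]•α n)) (sym (⊕-rotate (((+ n) / a) • α) (n₁ ·ℕ β₁) (n₂ ·ℕ β₂))))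

lemma15 : (d : ℕ) → 2 ≤ d → NonSquare d →
          (β₁ β₂ : K) → InOKPlus d β₁ → InOKPlus d β₂ → IsIntegralBasis d β₁ β₂ →
          (a b : ℕ) → .{{_ : NonZero a}} → NonZero b →
          (α : K) → α ≡ (((a * b) ·ℕ β₂) ⊖ (a ·ℕ β₁)) → InOKPlus d α →
          ((γ : K) →
             ((InConeℚ β₁ β₂ α γ × IsAlgInt d γ)
               ⇔ (∃[ n ] ∃[ n₁ ] ∃[ n₂ ] (γ ≡ ((((+ n) / a) • α) ⊕ (n₁ ·ℕ β₁)) ⊕ (n₂ ·ℕ β₂))))
             × ((∃[ n ] ∃[ n₁ ] ∃[ n₂ ] (γ ≡ ((((+ n) / a) • α) ⊕ (n₁ ·ℕ β₁)) ⊕ (n₂ ·ℕ β₂)))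
               ⇔ InSG β₁ β₂ (((+ 1) / a) • α) γ))
lemma15 d _ _ β₁ β₂ _ _ basis a b _ α α≡ _ γ =
    mk⇔ InConeℚ∩𝔒⇒Representable (λ γ-rep → Representable⇒InConeℚ γ-rep , Representable⇒IsAlgInt γ-rep)
  , mk⇔ Representable⇒InSG InSG⇒Representable
  where open ConeOverIntegralBasis d basis a b α≡
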